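{- Let $\ell\ge1$, let $\mathcal{T}$ be an $\ell$-index-tree, let $b\in\{1,\dots,\ell\}$ and let $i,j<b$ be indices such that $i \sim_b j$. Then either both $i$ and $j$ lie in $\mathcal{T}(b^-)$, or there is an ancestor $k$ of $b$ (possibly $k=b$) such that both $i$ and $j$ lie in $\mathcal{T}(k^+)$.
   Context: A partial binary tree is a rooted tree in which every node has at most one left child and at most one right child. An $\ell$-index-tree is a partial binary tree whose vertices (indices) are $1,\dots,\ell$, labelled so that in the depth-first preorder traversal from the root visiting left children before right children, the $k$-th visited node gets label $\ell+1-k$. For an index $i$, $i^-$, $i^+$ are its left and right children, $\mathcal{T}(i)$ is the subtree rooted at $i$, and $\mathcal{T}(i^-)$, $\mathcal{T}(i^+)$ are the subtrees rooted at $i^-,i^+$ (empty if the child does not exist). An ancestor of a node $t$ is a node on the path from $t$ to the root (including $t$). Words are finite sequences of letters; $\circ$ is concatenation; a factor is a contiguous subword. The full index-barrier $B(i)$ is defined recursively by: $B(i)=i$ if $i$ is a leaf; $B(i)=i\circ B(i-1)\circ i$ if $i$ has exactly one child (necessarily $i-1$); $B(i)=i\circ B(i^-)\circ i\circ B(i^+)\circ i\circ B(i^-)\circ i$ if $i$ has two children. For $b\in\{1,\dots,\ell+1\}$ and integers $i,j<b$ in $\{1,\dots,\ell\}$, we write $i\sim_b j$ if there is a factor of $B(\ell)$ containing both $i$ and $j$ but not containing $b$. -}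

module Defs where

open import Data.Nat using (ℕ; zero; suc; _+_; _∸_; _≤_; _<_)
open import Data.List using (List; []; _∷_; _++_; [_])
open import Data.List.Membership.Propositional using (_∈_; _∉_)
open import Data.Product using (Σ; ∃; _×_; _,_)
open import Relation.Binary.PropositionalEquality using (_≡_)

data BT : Set where
  empty : BT
  node  : BT → BT → BT

size : BT → ℕ
size empty      = 0
size (node l r) = suc (size l + size r)

-- An ℓ-index-tree is a shape t with size t ≡ ℓ; its labels are forced by
-- the preorder rule: the k-th visited node (left before right) gets ℓ+1-k.
-- So if a subtree is rooted at label n, its left child has label n-1 and
-- its right child has label n-1-(size of left subtree).

labels : BT → ℕ → List ℕ
labels empty      n = []
labels (node l r) n = n ∷ (labels l (n ∸ 1) ++ labels r (n ∸ 1 ∸ size l))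

-- Sub t n x s : in the (sub)tree t whose root is labelled n, the node
-- labelled x exists and the subtree T(x) rooted at it has shape s.
data Sub : BT → ℕ → ℕ → BT → Set where
  here  : ∀ {l r n} → Sub (node l r) n n (node l r)
  left  : ∀ {l r n x s} → Sub l (n ∸ 1) x s → Sub (node l r) n x s
  right : ∀ {l r n x s} → Sub r (n ∸ 1 ∸ size l) x s → Sub (node l r) n x s

barrier : BT → ℕ → List ℕ
barrier empty                          n = []
barrier (node empty empty)             n = [ n ]
barrier (node (node a b) empty)        n = n ∷ (barrier (node a b) (n ∸ 1) ++ [ n ])
barrier (node empty (node c d))        n = n ∷ (barrier (node c d) (n ∸ 1) ++ [ n ])
barrier (node (node a b) (node c d))   n =
  n ∷ (barrier (node a b) (n ∸ 1) ++ (n ∷ (barrier (node c d) (n ∸ 1 ∸ size (node a b))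
    ++ (n ∷ (barrier (node a b) (n ∸ 1) ++ [ n ])))))

B : BT → ℕ → List ℕ
B t ℓ = barrier t ℓ

Sim : BT → ℕ → ℕ → ℕ → ℕ → Set
Sim t ℓ b i j = Σ (List ℕ) λ u → Σ (List ℕ) λ v → Σ (List ℕ) λ w →
  (B t ℓ ≡ u ++ (v ++ w)) × (i ∈ v) × (j ∈ v) × (b ∉ v)

InLeft : BT → ℕ → ℕ → ℕ → Set
InLeft t ℓ x i = Σ BT λ l → Σ BT λ r → Sub t ℓ x (node l r) × (i ∈ labels l (x ∸ 1))

InRight : BT → ℕ → ℕ → ℕ → Set
InRight t ℓ x i = Σ BT λ l → Σ BT λ r →
  Sub t ℓ x (node l r) × (i ∈ labels r (x ∸ 1 ∸ size l))

Ancestor : BT → ℕ → ℕ → ℕ → Set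
Ancestor t ℓ k y = Σ BT λ s → Sub t ℓ k s × (y ∈ labels s k)

{-# OPTIONS --safe #-}
-- B(n) has the shape n X₁ n X₂ … n Xₖ n with blocks Xᵢ ∈ {B(n⁻), B(n⁺)}, and in the preorder
-- numbering every label of T(n⁺) lies below every label of T(n⁻).  The key fact is that for
-- x < b with b in the tree, the first b of the barrier comes before the first x; since barriers
-- are palindromes, the last b also comes after the last x.  Now let v be a factor avoiding b.
-- If v lies inside one block, either that block belongs to the subtree containing b and we
-- recurse, or b is the root (then i, j ∈ T(b⁻)), or the block is B(n⁺) and b is not in T(n⁺)
-- (then k = n).  Otherwise v contains a separator n, and each x < b in v lies in a prefix or
-- suffix of a block that is contained in v; by the key fact this block is B(n⁺) and b lies in
-- T(n⁻), so again k = n.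
module Submission where

open import Defs
open import Data.Nat using (ℕ; zero; suc; _+_; _∸_; _≤_; _<_; s≤s; z≤n; _≟_)
open import Data.Nat.Properties
  using (≤-refl; ≤-trans; ≤-<-trans; <-≤-trans; <-asym; <⇒≢; <⇒≱; <⇒≤pred; ≤∧≢⇒<; +-comm;
         +-monoʳ-≤; +-cancelˡ-<; m≤n+m; m<m+n; m+n≤o⇒m≤o; m+n≤o⇒m≤o∸n; m∸n≤m; m≤n+m∸n;
         m+[n∸m]≡n; ∸-+-assoc; ∸-monoˡ-<; module ≤-Reasoning)
open import Data.List using (List; []; _∷_; _++_; [_]; reverse)
open import Data.List.Properties using (∷-injective; ++-assoc; ++-identityʳ; reverse-++; unfold-reverse)
open import Data.List.Membership.Propositional using (_∈_; _∉_)
open import Data.List.Membership.Propositional.Properties using (∈-++⁺ˡ; ∈-++⁺ʳ; ∈-++⁻)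
open import Data.List.Relation.Unary.Any using (here; there)
open import Data.List.Relation.Unary.Any.Properties using (reverse⁺; reverse⁻)
open import Data.Product using (Σ; ∃; ∃₂; _×_; _,_; proj₁; proj₂)
open import Data.Sum using (_⊎_; inj₁; inj₂; [_,_]′; map₂)
open import Function using (_∘_; id)
open import Relation.Nullary using (yes; no; contradiction)
open import Relation.Binary.PropositionalEquality
  using (_≡_; _≢_; refl; sym; cong; cong₂; subst; module ≡-Reasoning)

module _ {A : Set} where

  open import Data.List.Relation.Binary.Subset.Propositional {A = A} using (_⊆_)

  -- The second alternative is strict (y ∷ m is nonempty), which spares callers an empty-overlap case.
  ++-split : ∀ (a c : List A) {b d} → a ++ b ≡ c ++ d →
    (∃ λ m → c ≡ a ++ m × b ≡ m ++ d) ⊎ (∃₂ λ y m → a ≡ c ++ y ∷ m × d ≡ y ∷ m ++ b)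
  ++-split []      c       eq = inj₁ (c , refl , eq)
  ++-split (x ∷ a) []      eq = inj₂ (x , a , refl , sym eq)
  ++-split (x ∷ a) (y ∷ c) eq with ∷-injective eq
  ... | refl , eq′ with ++-split a c eq′
  ...   | inj₁ (m , c≡ , b≡)     = inj₁ (m , cong (x ∷_) c≡ , b≡)
  ...   | inj₂ (z , m , a≡ , d≡) = inj₂ (z , m , cong (x ∷_) a≡ , d≡)

  Factor : List A → List A → Set
  Factor v L = ∃₂ λ u w → L ≡ u ++ (v ++ w)

  ∈-factor : ∀ {v L} → Factor v L → v ⊆ L
  ∈-factor (u , w , refl) x∈v = ∈-++⁺ʳ u (∈-++⁺ˡ x∈v)

  Affix : List A → List A → Set
  Affix p Y = (∃ λ q → Y ≡ p ++ q) ⊎ (∃ λ q → Y ≡ q ++ p)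

  ∈-affix : ∀ {p Y} → Affix p Y → p ⊆ Y
  ∈-affix (inj₁ (q , refl)) = ∈-++⁺ˡ
  ∈-affix (inj₂ (q , refl)) = ∈-++⁺ʳ q

  -- b occurs before the first occurrence of x in L (vacuous when x ∉ L).
  Precedes : A → A → List A → Set
  Precedes b x L = ∀ {p q} → L ≡ p ++ q → x ∈ p → b ∈ p

  precedes-head : ∀ {b x L} → Precedes b x (b ∷ L)
  precedes-head {p = _ ∷ _} eq _ = here (proj₁ (∷-injective eq))

  precedes-∷ : ∀ {a b x L} → x ≢ a → Precedes b x L → Precedes b x (a ∷ L)
  precedes-∷ x≢a pre {p = _ ∷ _} eq x∈ with ∷-injective eq | x∈
  ... | refl , _  | here refl = contradiction refl x≢a
  ... | refl , eq′ | there x∈p = there (pre eq′ x∈p)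

  precedes-++ˡ : ∀ {b x Y L} → b ∈ Y → Precedes b x Y → Precedes b x (Y ++ L)
  precedes-++ˡ {Y = Y} b∈Y pre {p} eq x∈p with ++-split Y p eq
  ... | inj₁ (m , refl , _)     = ∈-++⁺ˡ b∈Y
  ... | inj₂ (_ , _ , Y≡ , _) = pre Y≡ x∈p

  precedes-++ʳ : ∀ {b x Y L} → x ∉ Y → Precedes b x L → Precedes b x (Y ++ L)
  precedes-++ʳ {Y = Y} x∉Y pre {p} eq x∈p with ++-split Y p eq
  ... | inj₂ (_ , _ , refl , _) = contradiction (∈-++⁺ˡ x∈p) x∉Y
  ... | inj₁ (m , refl , L≡) with ∈-++⁻ Y x∈p
  ...   | inj₁ x∈Y = contradiction x∈Y x∉Y
  ...   | inj₂ x∈m = ∈-++⁺ʳ Y (pre L≡ x∈m)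

  Palindrome : List A → Set
  Palindrome L = reverse L ≡ L

  palindrome-wrap : ∀ a {L} → Palindrome L → Palindrome (a ∷ (L ++ [ a ]))
  palindrome-wrap a {L} pal = begin
    reverse (a ∷ (L ++ [ a ]))   ≡⟨ unfold-reverse a (L ++ [ a ]) ⟩
    reverse (L ++ [ a ]) ++ [ a ] ≡⟨ cong (_++ [ a ]) (reverse-++ L [ a ]) ⟩
    a ∷ (reverse L ++ [ a ])     ≡⟨ cong (λ M → a ∷ (M ++ [ a ])) pal ⟩
    a ∷ (L ++ [ a ])             ∎
    where open ≡-Reasoning

  palindrome-sandwich : ∀ {P C} → Palindrome P → Palindrome C → Palindrome (P ++ (C ++ P))
  palindrome-sandwich {P} {C} palP palC = begin
    reverse (P ++ (C ++ P))             ≡⟨ reverse-++ P (C ++ P) ⟩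
    reverse (C ++ P) ++ reverse P       ≡⟨ cong (_++ reverse P) (reverse-++ C P) ⟩
    (reverse P ++ reverse C) ++ reverse P ≡⟨ cong₂ (λ X Y → (X ++ Y) ++ X) palP palC ⟩
    (P ++ C) ++ P                       ≡⟨ ++-assoc P C P ⟩
    P ++ (C ++ P)                       ∎
    where open ≡-Reasoning

  palindrome-precedes-suffix : ∀ {b x L p q} → Palindrome L → Precedes b x L →
    L ≡ q ++ p → x ∈ p → b ∈ p
  palindrome-precedes-suffix {L = L} {p} {q} pal pre eq x∈p =
    reverse⁻ (pre L≡ (reverse⁺ x∈p))
    where
    open ≡-Reasoning
    L≡ : L ≡ reverse p ++ reverse q
    L≡ = begin
      L               ≡⟨ sym pal ⟩
      reverse L       ≡⟨ cong reverse eq ⟩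
      reverse (q ++ p) ≡⟨ reverse-++ q p ⟩
      reverse p ++ reverse q ∎

  fenced : A → List (List A) → List A
  fenced n []       = [ n ]
  fenced n (X ∷ Xs) = n ∷ (X ++ fenced n Xs)

  fenced-starts : ∀ {n Xs y L} → fenced n Xs ≡ y ∷ L → n ≡ y
  fenced-starts {Xs = []}    eq = proj₁ (∷-injective eq)
  fenced-starts {Xs = _ ∷ _} eq = proj₁ (∷-injective eq)

  separator∈fenced : ∀ {n} Xs → n ∈ fenced n Xs
  separator∈fenced []      = here refl
  separator∈fenced (_ ∷ _) = here refl

  precedes-fenced-head : ∀ {n x} Xs → Precedes n x (fenced n Xs)
  precedes-fenced-head []      = precedes-head
  precedes-fenced-head (_ ∷ _) = precedes-head

  block⊆fenced : ∀ {n Y Xs} → Y ∈ Xs → Y ⊆ fenced n Xs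
  block⊆fenced {Xs = X ∷ _} (here refl) = there ∘ ∈-++⁺ˡ
  block⊆fenced {Xs = X ∷ _} (there Y∈)  = there ∘ ∈-++⁺ʳ X ∘ block⊆fenced Y∈

  fenced⊆ : ∀ {n Xs Z} → n ∈ Z → (∀ {Y} → Y ∈ Xs → Y ⊆ Z) → fenced n Xs ⊆ Z
  fenced⊆ {Xs = []}     n∈Z blocks⊆ (here refl) = n∈Z
  fenced⊆ {Xs = X ∷ Xs} n∈Z blocks⊆ (here refl) = n∈Z
  fenced⊆ {Xs = X ∷ Xs} n∈Z blocks⊆ (there x∈) with ∈-++⁻ X x∈
  ... | inj₁ x∈X = blocks⊆ (here refl) x∈X
  ... | inj₂ x∈F = fenced⊆ n∈Z (blocks⊆ ∘ there) x∈F

  InBlockAffix : List (List A) → List A → A → Set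
  InBlockAffix Xs v x = ∃₂ λ Y p → Y ∈ Xs × Affix p Y × x ∈ p × p ⊆ v

  InBlockAffix-mono : ∀ {X Xs v v′ x} → v ⊆ v′ → InBlockAffix Xs v x → InBlockAffix (X ∷ Xs) v′ x
  InBlockAffix-mono v⊆v′ (Y , p , Y∈ , affix , x∈p , p⊆v) = Y , p , there Y∈ , affix , x∈p , v⊆v′ ∘ p⊆v

  prefix-fenced : ∀ {n} Xs {p q x} → fenced n Xs ≡ p ++ q → x ∈ p → x ≡ n ⊎ InBlockAffix Xs p x
  prefix-fenced Xs {_ ∷ _} eq (here refl) = inj₁ (sym (fenced-starts eq))
  prefix-fenced [] {_ ∷ _ ∷ _} eq (there _) with () ← proj₂ (∷-injective eq)
  prefix-fenced (X ∷ Xs) {_ ∷ p} eq (there x∈p) with ++-split X p (proj₂ (∷-injective eq))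
  ... | inj₂ (y , m , refl , _) = inj₂ (X , p , here refl , inj₁ (y ∷ m , refl) , x∈p , there)
  ... | inj₁ (m , refl , rest) with ∈-++⁻ X x∈p
  ...   | inj₁ x∈X = inj₂ (X , X , here refl , inj₁ ([] , sym (++-identityʳ X)) , x∈X , there ∘ ∈-++⁺ˡ)
  ...   | inj₂ x∈m = map₂ (InBlockAffix-mono (there ∘ ∈-++⁺ʳ X)) (prefix-fenced Xs rest x∈m)

  data FencedFactor (n : A) (Xs : List (List A)) (v : List A) : Set where
    inside : ∀ {Y} → Y ∈ Xs → Factor v Y → FencedFactor n Xs v
    across : n ∈ v → (∀ {x} → x ∈ v → x ≡ n ⊎ InBlockAffix Xs v x) → FencedFactor n Xs v

  FencedFactor-∷ : ∀ {n X Xs v} → FencedFactor n Xs v → FencedFactor n (X ∷ Xs) v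
  FencedFactor-∷ (inside Y∈ f)      = inside (there Y∈) f
  FencedFactor-∷ (across n∈v cover) = across n∈v (map₂ (InBlockAffix-mono id) ∘ cover)

  factor-fenced : ∀ {n} Xs {v x} → Factor v (fenced n Xs) → x ∈ v → FencedFactor n Xs v
  factor-fenced Xs {_ ∷ _} ([] , w , eq) _ =
    across (here (fenced-starts eq)) (prefix-fenced Xs eq)
  factor-fenced [] (_ ∷ u , w , eq) x∈v with () ← ∈-factor (u , w , proj₂ (∷-injective eq)) x∈v
  factor-fenced {n} (X ∷ Xs) {v} (_ ∷ u , w , eq) x∈v with ++-split X u (proj₂ (∷-injective eq))
  ... | inj₁ (m , refl , rest) = FencedFactor-∷ (factor-fenced Xs (m , w , rest) x∈v)
  ... | inj₂ (y , m , refl , vw≡) with ++-split v (y ∷ m) vw≡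
  ...   | inj₁ (m′ , ym≡ , _) = inside (here refl) (u , m′ , cong (u ++_) ym≡)
  ...   | inj₂ (z , m′ , refl , rest) =
    across (∈-++⁺ʳ (y ∷ m) (here (fenced-starts rest))) cover
    where
    cover : ∀ {x} → x ∈ (y ∷ m) ++ z ∷ m′ → x ≡ n ⊎ InBlockAffix (X ∷ Xs) ((y ∷ m) ++ z ∷ m′) x
    cover x∈ with ∈-++⁻ (y ∷ m) x∈
    ... | inj₁ x∈ym = inj₂ (_ , y ∷ m , here refl , inj₂ (u , refl) , x∈ym , ∈-++⁺ˡ)
    ... | inj₂ x∈zm = map₂ (InBlockAffix-mono (∈-++⁺ʳ (y ∷ m))) (prefix-fenced Xs rest x∈zm)

open import Data.List.Relation.Binary.Subset.Propositional {A = ℕ} using (_⊆_)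

countdown : ℕ → ℕ → List ℕ
countdown zero    n = []
countdown (suc k) n = n ∷ countdown k (n ∸ 1)

countdown-+ : ∀ a b n → countdown (a + b) n ≡ countdown a n ++ countdown b (n ∸ a)
countdown-+ zero    b n = refl
countdown-+ (suc a) b n = cong (n ∷_) (begin
  countdown (a + b) (n ∸ 1)                       ≡⟨ countdown-+ a b (n ∸ 1) ⟩
  countdown a (n ∸ 1) ++ countdown b (n ∸ 1 ∸ a)
    ≡⟨ cong (λ m → countdown a (n ∸ 1) ++ countdown b m) (∸-+-assoc n 1 a) ⟩
  countdown a (n ∸ 1) ++ countdown b (n ∸ suc a)  ∎)
  where open ≡-Reasoning

∈-countdown⁻ : ∀ k n {x} → x ∈ countdown k n → x ≤ n × n < k + x
∈-countdown⁻ (suc k) n (here refl) = ≤-refl , s≤s (m≤n+m n k)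
∈-countdown⁻ (suc k) n (there x∈) with ∈-countdown⁻ k (n ∸ 1) x∈
... | x≤ , n∸1< = ≤-trans x≤ (m∸n≤m n 1) , ≤-<-trans (m≤n+m∸n n 1) (s≤s n∸1<)

∈-countdown⁺ : ∀ k n {x} → x ≤ n → n < k + x → x ∈ countdown k n
∈-countdown⁺ zero    n x≤n n<x = contradiction x≤n (<⇒≱ n<x)
∈-countdown⁺ (suc k) n {x} x≤n n< with x ≟ n
... | yes refl = here refl
... | no x≢n   =
  there (∈-countdown⁺ k (n ∸ 1) (<⇒≤pred x<n) (∸-monoˡ-< n< (≤-trans (s≤s z≤n) x<n)))
  where
  x<n : x < n
  x<n = ≤∧≢⇒< x≤n x≢n

labels≡countdown : ∀ t n → labels t n ≡ countdown (size t) n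
labels≡countdown empty      n = refl
labels≡countdown (node l r) n = cong (n ∷_) (begin
  labels l (n ∸ 1) ++ labels r (n ∸ 1 ∸ size l)
    ≡⟨ cong₂ _++_ (labels≡countdown l (n ∸ 1)) (labels≡countdown r (n ∸ 1 ∸ size l)) ⟩
  countdown (size l) (n ∸ 1) ++ countdown (size r) (n ∸ 1 ∸ size l)
    ≡⟨ countdown-+ (size l) (size r) (n ∸ 1) ⟨
  countdown (size l + size r) (n ∸ 1) ∎)
  where open ≡-Reasoning

∈-labels⁻ : ∀ t n {x} → x ∈ labels t n → x ≤ n × n < size t + x
∈-labels⁻ t n = ∈-countdown⁻ (size t) n ∘ subst (_ ∈_) (labels≡countdown t n)

∈-labels⁺ : ∀ t n {x} → x ≤ n → n < size t + x → x ∈ labels t n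
∈-labels⁺ t n x≤n n< = subst (_ ∈_) (sym (labels≡countdown t n)) (∈-countdown⁺ (size t) n x≤n n<)

right<left : ∀ l r n {x y} → size l ≤ n → y ∈ labels r (n ∸ size l) → x ∈ labels l n → y < x
right<left l r n {x} {y} fits y∈ x∈ = +-cancelˡ-< (size l) y x (begin-strict
  size l + y            ≤⟨ +-monoʳ-≤ (size l) (proj₁ (∈-labels⁻ r (n ∸ size l) y∈)) ⟩
  size l + (n ∸ size l) ≡⟨ m+[n∸m]≡n fits ⟩
  n                     <⟨ proj₂ (∈-labels⁻ l n x∈) ⟩
  size l + x            ∎)
  where open ≤-Reasoning

left-fits : ∀ l r {n} → size l + size r ≤ n → size l ≤ n
left-fits l r = m+n≤o⇒m≤o (size l)

right-fits : ∀ l r {n} → size l + size r ≤ n → size r ≤ n ∸ size l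
right-fits l r {n} fits = m+n≤o⇒m≤o∸n (size r) (subst (_≤ n) (+-comm (size l) (size r)) fits)

blocks : BT → BT → ℕ → List (List ℕ)
blocks empty         empty         n = []
blocks l@(node _ _) empty         n = [ barrier l (n ∸ 1) ]
blocks empty         r@(node _ _) n = [ barrier r (n ∸ 1) ]
blocks l@(node _ _) r@(node _ _) n =
  barrier l (n ∸ 1) ∷ barrier r (n ∸ 1 ∸ size l) ∷ barrier l (n ∸ 1) ∷ []

barrier≡fenced : ∀ l r n → barrier (node l r) n ≡ fenced n (blocks l r n)
barrier≡fenced empty      empty      n = refl
barrier≡fenced (node _ _) empty      n = refl
barrier≡fenced empty      (node _ _) n = refl
barrier≡fenced (node _ _) (node _ _) n = refl

blocks-member : ∀ l r n {Y} → Y ∈ blocks l r n →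
  Y ≡ barrier l (n ∸ 1) ⊎ Y ≡ barrier r (n ∸ 1 ∸ size l)
blocks-member (node _ _) empty      n (here refl)                 = inj₁ refl
blocks-member empty      (node _ _) n (here refl)                 = inj₂ refl
blocks-member (node _ _) (node _ _) n (here refl)                 = inj₁ refl
blocks-member (node _ _) (node _ _) n (there (here refl))         = inj₂ refl
blocks-member (node _ _) (node _ _) n (there (there (here refl))) = inj₁ refl

left-block : ∀ l r n {x} → x ∈ labels l (n ∸ 1) → barrier l (n ∸ 1) ∈ blocks l r n
left-block (node _ _) empty      n _ = here refl
left-block (node _ _) (node _ _) n _ = here refl

right-block : ∀ l r n {x} → x ∈ labels r (n ∸ 1 ∸ size l) → barrier r (n ∸ 1 ∸ size l) ∈ blocks l r n
right-block empty      (node _ _) n _ = here refl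
right-block (node _ _) (node _ _) n _ = there (here refl)

barrier⊆labels : ∀ t n → barrier t n ⊆ labels t n
barrier⊆labels (node l r) n =
  fenced⊆ (here refl) block⊆labels ∘ subst (_ ∈_) (barrier≡fenced l r n)
  where
  block⊆labels : ∀ {Y} → Y ∈ blocks l r n → Y ⊆ labels (node l r) n
  block⊆labels Y∈ with blocks-member l r n Y∈
  ... | inj₁ refl = there ∘ ∈-++⁺ˡ ∘ barrier⊆labels l (n ∸ 1)
  ... | inj₂ refl = there ∘ ∈-++⁺ʳ (labels l (n ∸ 1)) ∘ barrier⊆labels r (n ∸ 1 ∸ size l)

labels⊆barrier : ∀ t n → labels t n ⊆ barrier t n
labels⊆barrier (node l r) n x∈ = subst (_ ∈_) (sym (barrier≡fenced l r n)) (∈-fenced x∈)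
  where
  ∈-fenced : labels (node l r) n ⊆ fenced n (blocks l r n)
  ∈-fenced (here refl) = separator∈fenced (blocks l r n)
  ∈-fenced (there x∈) with ∈-++⁻ (labels l (n ∸ 1)) x∈
  ... | inj₁ x∈l = block⊆fenced (left-block l r n x∈l) (labels⊆barrier l (n ∸ 1) x∈l)
  ... | inj₂ x∈r = block⊆fenced (right-block l r n x∈r) (labels⊆barrier r (n ∸ 1 ∸ size l) x∈r)

factor⊆labels : ∀ t n {v} → Factor v (barrier t n) → v ⊆ labels t n
factor⊆labels t n f = barrier⊆labels t n ∘ ∈-factor f

barrier-palindrome : ∀ t n → Palindrome (barrier t n)
barrier-palindrome empty                          n = refl
barrier-palindrome (node empty empty)             n = refl
barrier-palindrome (node l@(node _ _) empty)      n = palindrome-wrap n (barrier-palindrome l (n ∸ 1))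
barrier-palindrome (node empty r@(node _ _))      n = palindrome-wrap n (barrier-palindrome r (n ∸ 1))
barrier-palindrome (node l@(node _ _) r@(node _ _)) n =
  subst Palindrome (cong (n ∷_) (++-assoc Bl [ n ] (Br ++ (n ∷ (Bl ++ [ n ])))))
    (palindrome-sandwich (palindrome-wrap n (barrier-palindrome l (n ∸ 1)))
                         (barrier-palindrome r (n ∸ 1 ∸ size l)))
  where
  Bl Br : List ℕ
  Bl = barrier l (n ∸ 1)
  Br = barrier r (n ∸ 1 ∸ size l)

data Position (l r : BT) (n : ℕ) : ℕ → Set where
  atRoot  : Position l r n (suc n)
  inLeft  : ∀ {b} → b ∈ labels l n → Position l r n b
  inRight : ∀ {b} → b ∈ labels r (n ∸ size l) → Position l r n b

position : ∀ l r n {b} → b ∈ labels (node l r) (suc n) → Position l r n b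
position l r n (here refl) = atRoot
position l r n (there b∈)  = [ inLeft , inRight ]′ (∈-++⁻ (labels l n) b∈)

<-label⇒≢-root : ∀ t n {b x} → b ∈ labels t n → x < b → x ≢ n
<-label⇒≢-root t n b∈ x<b = <⇒≢ (<-≤-trans x<b (proj₁ (∈-labels⁻ t n b∈)))

precedes-left : ∀ l r n {b x} → x ≢ n → b ∈ barrier l (n ∸ 1) →
  Precedes b x (barrier l (n ∸ 1)) → Precedes b x (barrier (node l r) n)
precedes-left (node _ _) empty      n x≢n b∈ pre = precedes-∷ x≢n (precedes-++ˡ b∈ pre)
precedes-left (node _ _) (node _ _) n x≢n b∈ pre = precedes-∷ x≢n (precedes-++ˡ b∈ pre)

precedes-right : ∀ l r n {b x} → x ≢ n → x ∉ barrier l (n ∸ 1) → b ∈ barrier r (n ∸ 1 ∸ size l) →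
  Precedes b x (barrier r (n ∸ 1 ∸ size l)) → Precedes b x (barrier (node l r) n)
precedes-right empty      (node _ _) n x≢n x∉ b∈ pre = precedes-∷ x≢n (precedes-++ˡ b∈ pre)
precedes-right (node _ _) (node _ _) n x≢n x∉ b∈ pre =
  precedes-∷ x≢n (precedes-++ʳ x∉ (precedes-∷ x≢n (precedes-++ˡ b∈ pre)))

precedes-barrier : ∀ t n {b x} → size t ≤ n → b ∈ labels t n → x < b → Precedes b x (barrier t n)
precedes-barrier (node l r) (suc n) {b} {x} (s≤s fits) b∈ x<b with position l r n b∈
... | atRoot =
  subst (Precedes b x) (sym (barrier≡fenced l r (suc n))) (precedes-fenced-head (blocks l r (suc n)))
... | inLeft b∈l =
  precedes-left l r (suc n) (<-label⇒≢-root (node l r) (suc n) b∈ x<b) (labels⊆barrier l n b∈l)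
    (precedes-barrier l n (left-fits l r fits) b∈l x<b)
... | inRight b∈r =
  precedes-right l r (suc n) (<-label⇒≢-root (node l r) (suc n) b∈ x<b) x∉left
    (labels⊆barrier r (n ∸ size l) b∈r) (precedes-barrier r (n ∸ size l) (right-fits l r fits) b∈r x<b)
  where
  x∉left : x ∉ barrier l n
  x∉left x∈ = <-asym x<b (right<left l r n (left-fits l r fits) b∈r (barrier⊆labels l n x∈))

affix-barrier : ∀ t n {b x p} → size t ≤ n → b ∈ labels t n → x < b →
  Affix p (barrier t n) → x ∈ p → b ∈ p
affix-barrier t n fits b∈ x<b (inj₁ (_ , eq)) = precedes-barrier t n fits b∈ x<b eq
affix-barrier t n fits b∈ x<b (inj₂ (_ , eq)) =
  palindrome-precedes-suffix (barrier-palindrome t n) (precedes-barrier t n fits b∈ x<b) eq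

ShareSubtree : BT → ℕ → ℕ → ℕ → ℕ → Set
ShareSubtree t n b i j =
  (InLeft t n b i × InLeft t n b j)
  ⊎ Σ ℕ (λ k → Ancestor t n k b × InRight t n k i × InRight t n k j)

ShareSubtree-lift : ∀ {t m t′ n b i j} → (∀ {x s} → Sub t m x s → Sub t′ n x s) →
  ShareSubtree t m b i j → ShareSubtree t′ n b i j
ShareSubtree-lift emb (inj₁ ((l , r , s , i∈) , (l′ , r′ , s′ , j∈))) =
  inj₁ ((l , r , emb s , i∈) , (l′ , r′ , emb s′ , j∈))
ShareSubtree-lift emb (inj₂ (k , (s₀ , sb , b∈) , (l , r , s , i∈) , (l′ , r′ , s′ , j∈))) =
  inj₂ (k , (s₀ , emb sb , b∈) , (l , r , emb s , i∈) , (l′ , r′ , emb s′ , j∈))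

share-root-left : ∀ {l r n i j} → i ∈ labels l (n ∸ 1) → j ∈ labels l (n ∸ 1) →
  ShareSubtree (node l r) n n i j
share-root-left {l} {r} i∈ j∈ = inj₁ ((l , r , here , i∈) , (l , r , here , j∈))

share-root-right : ∀ {l r n b i j} → b ∈ labels (node l r) n →
  i ∈ labels r (n ∸ 1 ∸ size l) → j ∈ labels r (n ∸ 1 ∸ size l) → ShareSubtree (node l r) n b i j
share-root-right {l} {r} {n} b∈ i∈ j∈ =
  inj₂ (n , (node l r , here , b∈) , (l , r , here , i∈) , (l , r , here , j∈))

across-right : ∀ l r n {b x v} → size l + size r ≤ n → b ∈ labels (node l r) (suc n) →
  b ∉ v → suc n ∈ v → x < b → x ≡ suc n ⊎ InBlockAffix (blocks l r (suc n)) v x →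
  x ∈ labels r (n ∸ size l)
across-right l r n fits b∈ b∉v n∈v x<b (inj₁ refl) =
  contradiction refl (<-label⇒≢-root (node l r) (suc n) b∈ x<b)
across-right l r n fits b∈ b∉v n∈v x<b (inj₂ (Y , p , Y∈ , affix , x∈p , p⊆v))
  with blocks-member l r (suc n) Y∈ | position l r n b∈
... | inj₂ refl | _           = barrier⊆labels r (n ∸ size l) (∈-affix affix x∈p)
... | inj₁ refl | atRoot      = contradiction n∈v b∉v
... | inj₁ refl | inLeft b∈l  =
  contradiction (p⊆v (affix-barrier l n (left-fits l r fits) b∈l x<b affix x∈p)) b∉v
... | inj₁ refl | inRight b∈r =
  contradiction (right<left l r n (left-fits l r fits) b∈r (barrier⊆labels l n (∈-affix affix x∈p)))
    (<-asym x<b)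

share-subtree : ∀ t n {b i j v} → size t ≤ n → b ∈ labels t n → i < b → j < b →
  Factor v (barrier t n) → i ∈ v → j ∈ v → b ∉ v → ShareSubtree t n b i j
share-subtree (node l r) (suc n) {b} {i} {j} {v} (s≤s fits) b∈ i<b j<b f i∈v j∈v b∉v
  with factor-fenced (blocks l r (suc n)) (subst (Factor v) (barrier≡fenced l r (suc n)) f) i∈v
... | across n∈v cover = share-root-right b∈
  (across-right l r n fits b∈ b∉v n∈v i<b (cover i∈v))
  (across-right l r n fits b∈ b∉v n∈v j<b (cover j∈v))
... | inside Y∈ fY with blocks-member l r (suc n) Y∈ | position l r n b∈
...   | inj₁ refl | atRoot      = share-root-left (factor⊆labels l n fY i∈v) (factor⊆labels l n fY j∈v)
...   | inj₁ refl | inLeft b∈l  =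
  ShareSubtree-lift left (share-subtree l n (left-fits l r fits) b∈l i<b j<b fY i∈v j∈v b∉v)
...   | inj₁ refl | inRight b∈r =
  contradiction (right<left l r n (left-fits l r fits) b∈r (factor⊆labels l n fY i∈v)) (<-asym i<b)
...   | inj₂ refl | inRight b∈r =
  ShareSubtree-lift right
    (share-subtree r (n ∸ size l) (right-fits l r fits) b∈r i<b j<b fY i∈v j∈v b∉v)
...   | inj₂ refl | _           =
  share-root-right b∈ (factor⊆labels r (n ∸ size l) fY i∈v) (factor⊆labels r (n ∸ size l) fY j∈v)

proposition3p15 : (ℓ : ℕ) → 1 ≤ ℓ → (t : BT) → size t ≡ ℓ →
    (b i j : ℕ) → 1 ≤ b → b ≤ ℓ → 1 ≤ i → 1 ≤ j → i < b → j < b →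
    Sim t ℓ b i j →
    (InLeft t ℓ b i × InLeft t ℓ b j)
    ⊎ Σ ℕ (λ k → Ancestor t ℓ k b × InRight t ℓ k i × InRight t ℓ k j)
proposition3p15 .(size t) _ t refl b i j 1≤b b≤ℓ _ _ i<b j<b (u , v , w , eq , i∈v , j∈v , b∉v) =
  share-subtree t (size t) ≤-refl b∈t i<b j<b (u , w , eq) i∈v j∈v b∉v
  where
  b∈t : b ∈ labels t (size t)
  b∈t = ∈-labels⁺ t (size t) b≤ℓ (m<m+n (size t) 1≤b)
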